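{- Let $(X,\pi)$ be a weighted $n$-partite simplicial complex, let $0\le\ell\le n$, and let $H$ be a labelled $k$-regular graph on $\binom{[n]}{\ell}$. Then the expanderized up-down walk $\widetilde P_H$ on $X^{(\ell)}$ via $H$ has $\pi_\ell$ as a stationary distribution, i.e. $\pi_\ell\widetilde P_H=\pi_\ell$, and it is reversible with respect to $\pi_\ell$, i.e. $\pi_\ell(\hat\omega)\widetilde P_H(\hat\omega,\tilde\omega)=\pi_\ell(\tilde\omega)\widetilde P_H(\tilde\omega,\hat\omega)$ for all $\hat\omega,\tilde\omega\in X^{(\ell)}$.
   Context: A pure simplicial complex of rank $n$ is a downward-closed family $X$ of subsets of a finite set all of whose inclusion-maximal members have size $n$; $X^{(j)}$ denotes its faces of size $j$. It is $n$-partite if $X^{(1)}$ is partitioned into sides $X[1],\dots,X[n]$ such that every $\omega\in X^{(n)}$ contains exactly one element of each side. $\mathrm{type}(\alpha)=\{i:\alpha\cap X[i]\neq\emptyset\}$; for $\omega\in X^{(n)}$, $S\subseteq[n]$, $\omega_S$ is the set of elements of $\omega$ in the sides indexed by $S$. $\pi$ is a full-support probability distribution on $X^{(n)}$, and $\pi_j(\alpha)=\binom{n}{j}^{ -1}\Pr_{\omega\sim\pi}[\omega\supseteq\alpha]$ for $\alpha\in X^{(j)}$. A labelled $k$-regular graph $H$ on $V$ is given by maps $\mathrm{Out}_H(\cdot,a):V\to V$, $a\in[k]$, with symmetric walk matrix $A_H(S,T)=|\{a:\mathrm{Out}_H(S,a)=T\}|/k$. The expanderized up-down walk via $H$ is the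 matrix on $X^{(\ell)}$ with $\widetilde P_H(\hat\omega,\tilde\omega)=A_H(\mathrm{type}(\hat\omega),\mathrm{type}(\tilde\omega))\cdot\Pr_{\omega\sim\pi}[\omega_{\mathrm{type}(\tilde\omega)}=\tilde\omega\mid\omega\supseteq\hat\omega]$.
   Formalization: The full-support distribution π on the facets takes positive rational values instead of real ones. -}

module Defs where

open import Data.Nat as ℕ using (ℕ; zero; suc; NonZero)
open import Data.Nat.Combinatorics using (_C_)
open import Data.Bool using (Bool; true; false; _∧_)
open import Data.Fin as Fin using (Fin)
open import Data.Fin.Properties using (any?)
open import Data.Fin.Subset using (Subset; _⊆_; _∩_; ∣_∣; inside; outside)
open import Data.Fin.Subset.Properties using (_⊆?_; nonempty?)
open import Data.Vec using (Vec; []; _∷_; tabulate; lookup)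
open import Data.Vec.Properties using (≡-dec)
open import Data.List using (List; []; _∷_; [_]; map; _++_; filter; foldr; allFin)
open import Data.Product using (Σ; ∃; _×_; _,_; proj₁)
open import Data.Rational using (ℚ; 0ℚ; 1ℚ; _+_; _*_; _÷_; _<_; ≢-nonZero)
open import Data.Rational.Properties using (_≟_)
import Data.Bool.Properties as BoolP
open import Relation.Nullary using (Dec; yes; no; ¬_)
open import Relation.Nullary.Decidable using (_×-dec_; ⌊_⌋)
open import Relation.Binary.PropositionalEquality using (_≡_)
open import Function using (Injective)

ℕtoℚ : ℕ → ℚ
ℕtoℚ zero    = 0ℚ
ℕtoℚ (suc k) = 1ℚ + ℕtoℚ k

sumℚ : List ℚ → ℚ
sumℚ = foldr _+_ 0ℚ

ΣFin : (N : ℕ) → (Fin N → ℚ) → ℚ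
ΣFin N f = sumℚ (map f (allFin N))

-- total division: p / q for q ≠ 0, and 0 when q = 0.
-- (Only ever applied with nonzero denominators in the statement's
--  relevant cases.)
_/ₜ_ : ℚ → ℚ → ℚ
p /ₜ q with q ≟ 0ℚ
... | yes _  = 0ℚ
... | no q≢0 = _÷_ p q {{≢-nonZero q≢0}}

_≟ₛ_ : ∀ {m} (a b : Subset m) → Dec (a ≡ b)
_≟ₛ_ = ≡-dec BoolP._≟_

countFin : (k : ℕ) → (P : Fin k → Set) → ((a : Fin k) → Dec (P a)) → ℕ
countFin k P P? = Data.List.length (filter P? (allFin k))
  where import Data.List

allSubsets : (m : ℕ) → List (Subset m)
allSubsets zero    = [ [] ]
allSubsets (suc m) = map (outside ∷_) (allSubsets m) ++ map (inside ∷_) (allSubsets m)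

-- The complex X is given by its (distinct) facets
-- facet i, i : Fin N, and X is their downward closure; every facet
-- contains exactly one element of each side (hence has size n), so X is
-- pure of rank n and n-partite.  π is a full-support probability
-- distribution on X^(n).

sideSet : ∀ {m n} → (Fin m → Fin n) → Fin n → Subset m
sideSet side j = tabulate (λ v → ⌊ side v Fin.≟ j ⌋)

typeOf : ∀ {m n} → (Fin m → Fin n) → Subset m → Subset n
typeOf side α = tabulate (λ j → ⌊ nonempty? (α ∩ sideSet side j) ⌋)

restrictTo : ∀ {m n} → (Fin m → Fin n) → Subset m → Subset n → Subset m
restrictTo side ω S = tabulate (λ v → lookup ω v ∧ lookup S (side v))

record WeightedPartiteComplex (n : ℕ) : Set where
  field
    m        : ℕ
    side     : Fin m → Fin n
    N        : ℕ
    facet    : Fin N → Subset m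
    facet-inj : Injective _≡_ _≡_ facet
    partite  : ∀ (i : Fin N) (j : Fin n) →
               ∣ facet i ∩ sideSet side j ∣ ≡ 1
    π        : Fin N → ℚ
    π-pos    : ∀ i → 0ℚ < π i
    π-sum    : ΣFin N π ≡ 1ℚ

Choose : ℕ → ℕ → Set
Choose n ℓ = Σ (Subset n) (λ S → ∣ S ∣ ≡ ℓ)

outCount : ∀ {n ℓ k} → (Choose n ℓ → Fin k → Choose n ℓ) → Choose n ℓ → Subset n → ℕ
outCount {k = k} Out S T = countFin k (λ a → proj₁ (Out S a) ≡ T) (λ a → proj₁ (Out S a) ≟ₛ T)

walkMatrix : ∀ {n ℓ k} → (Choose n ℓ → Fin k → Choose n ℓ) → Choose n ℓ → Choose n ℓ → ℚ
walkMatrix {k = k} Out S T = ℕtoℚ (outCount Out S (proj₁ T)) /ₜ ℕtoℚ k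

record LabelledRegularGraph (n ℓ k : ℕ) : Set where
  field
    Out       : Choose n ℓ → Fin k → Choose n ℓ
    symmetric : ∀ S T → walkMatrix Out S T ≡ walkMatrix Out T S

module UpDown {n : ℕ} (X : WeightedPartiteComplex n) (ℓ : ℕ) where
  open WeightedPartiteComplex X

  IsFace : Subset m → Set
  IsFace α = ∣ α ∣ ≡ ℓ × ∃ λ i → α ⊆ facet i

  isFace? : (α : Subset m) → Dec (IsFace α)
  isFace? α = (∣ α ∣ ℕ.≟ ℓ) ×-dec any? (λ i → α ⊆? facet i)

  faces : List (Subset m)
  faces = filter isFace? (allSubsets m)

  PrSup : Subset m → ℚ
  PrSup α = ΣFin N (λ i → if ⌊ α ⊆? facet i ⌋ then π i else 0ℚ)
    where open import Data.Bool using (if_then_else_)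

  πℓ : Subset m → ℚ
  πℓ α = PrSup α /ₜ ℕtoℚ (n C ℓ)

  PrCond : Subset n → Subset m → Subset m → ℚ
  PrCond T β α =
    ΣFin N (λ i → if ⌊ α ⊆? facet i ⌋ ∧ ⌊ restrictTo side (facet i) T ≟ₛ β ⌋ then π i else 0ℚ)
      /ₜ PrSup α
    where open import Data.Bool using (if_then_else_)

  module _ {k : ℕ} (H : LabelledRegularGraph n ℓ k) where
    open LabelledRegularGraph H

    -- A_H on types; types of non-ℓ-subsets never occur for faces of X^(ℓ)
    AH : Subset n → Subset n → ℚ
    AH S T with ∣ S ∣ ℕ.≟ ℓ | ∣ T ∣ ℕ.≟ ℓ
    ... | yes p | yes q = walkMatrix Out (S , p) (T , q)
    ... | _     | _     = 0ℚ

    P̃ : Subset m → Subset m → ℚ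
    P̃ ω̂ ω̃ = AH (typeOf side ω̂) (typeOf side ω̃) * PrCond (typeOf side ω̃) ω̃ ω̂

-- For a face α and any β, inside a facet ω the set β is the only subset of ω of its own
-- type, so Pr[ω_{type β} = β | ω ⊇ α] = Pr[ω ⊇ α ∪ β] / Pr[ω ⊇ α].  Hence the flow
-- π_ℓ(α) P̃(α,β) = A_H(type α, type β) · Pr[ω ⊇ α ∪ β] / C(n,ℓ) is symmetric in α and β,
-- which is reversibility.  For stationarity, sum the flow into β over α and exchange with
-- the sum over facets ω ⊇ β: on the subsets of a facet, α ↦ type α is a size-preserving
-- bijection onto the subsets of [n], so the inner sum is a row sum of A_H, which is 1 by
-- regularity, leaving Pr[ω ⊇ β] / C(n,ℓ) = π_ℓ(β).

module Submission where

open import Defs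
open import Data.Nat as ℕ using (ℕ; zero; suc; NonZero)
import Data.Nat.Properties as ℕP
open import Data.Nat.Combinatorics using (_C_)
open import Data.Bool using (Bool; true; false; _∧_; if_then_else_)
open import Data.Bool.Properties using (∧-comm; ∧-identityʳ; ∧-zeroʳ)
open import Data.Vec using ([]; _∷_; tabulate; lookup)
open import Data.Vec.Properties using (∷-injectiveʳ; lookup∘tabulate; lookup-zipWith; []=⇒lookup; lookup⇒[]=)
open import Data.Fin as Fin using (Fin)
import Data.Fin.Properties as FinP
open import Data.Fin.Subset using (Subset; inside; outside; _∈_; _⊆_; _∩_; _-_; ∣_∣; Nonempty)
open import Data.Fin.Subset.Properties
  using ( _⊆?_; nonempty?; Empty-unique; ∣⊥∣≡0; x∈p∩q⁺; x∈p∩q⁻; x∈p⇒∣p-x∣<∣p∣; x∈p∧x≢y⇒x∈p-y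
        ; p⊆q⇒∣p∣≤∣q∣; ⊆-antisym)
open import Data.List using (List; []; _∷_; map; _++_; filter; length; allFin)
open import Data.List.Properties using (map-∘; map-tabulate; length-tabulate)
open import Data.List.Membership.Propositional using () renaming (_∈_ to _∈ₗ_)
open import Data.List.Membership.Propositional.Properties using (∈-allFin)
open import Data.List.Relation.Unary.Any using (here; there)
open import Data.Product using (∃-syntax; _×_; _,_; proj₁; proj₂)
open import Data.Rational using (ℚ; 0ℚ; 1ℚ; _+_; _*_; _<_; _≤_; 1/_; ≢-nonZero)
open import Data.Rational.Properties
open import Data.Rational.Solver using (module +-*-Solver)
open import Algebra.Bundles using (AbelianGroup)
open import Algebra.Properties.Group (AbelianGroup.group +-0-abelianGroup) using (∙-cancelˡ)
open import Relation.Binary.PropositionalEquality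
open import Relation.Nullary using (Dec; yes; no; ¬_; contradiction)
open import Relation.Nullary.Decidable using (⌊_⌋; isYes≗does; dec-true; dec-false)
open import Function using (_∘_; id)

open +-*-Solver using (solve; _:+_; _:*_; _:=_)

𝟙 : Bool → ℚ
𝟙 b = if b then 1ℚ else 0ℚ

if-∧-then-0 : ∀ a b x → (if a ∧ b then x else 0ℚ) ≡ 𝟙 a * (if b then x else 0ℚ)
if-∧-then-0 true  b x = sym (*-identityˡ _)
if-∧-then-0 false b x = sym (*-zeroˡ (if b then x else 0ℚ))

⌊⌋-yes : ∀ {P : Set} (P? : Dec P) → P → ⌊ P? ⌋ ≡ true
⌊⌋-yes P? p = trans (isYes≗does P?) (dec-true P? p)

⌊⌋-no : ∀ {P : Set} (P? : Dec P) → ¬ P → ⌊ P? ⌋ ≡ false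
⌊⌋-no P? ¬p = trans (isYes≗does P?) (dec-false P? ¬p)

⌊⌋-true⇒ : ∀ {P : Set} (P? : Dec P) → ⌊ P? ⌋ ≡ true → P
⌊⌋-true⇒ (yes p) _ = p

𝟙-*-cong : ∀ {P : Set} (P? : Dec P) {x y} → (P → x ≡ y) → 𝟙 ⌊ P? ⌋ * x ≡ 𝟙 ⌊ P? ⌋ * y
𝟙-*-cong (yes p) x≡y = cong (1ℚ *_) (x≡y p)
𝟙-*-cong (no  _) {x} {y} _ = trans (*-zeroˡ x) (sym (*-zeroˡ y))

ℕtoℚ-nonNeg : ∀ a → 0ℚ ≤ ℕtoℚ a
ℕtoℚ-nonNeg zero    = ≤-refl
ℕtoℚ-nonNeg (suc a) = +-mono-≤ (<⇒≤ (positive⁻¹ 1ℚ)) (ℕtoℚ-nonNeg a)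

ℕtoℚ-suc-pos : ∀ a → 0ℚ < ℕtoℚ (suc a)
ℕtoℚ-suc-pos a = +-mono-<-≤ (positive⁻¹ 1ℚ) (ℕtoℚ-nonNeg a)

ℕtoℚ-nonZero : ∀ a → .{{NonZero a}} → ℕtoℚ a ≢ 0ℚ
ℕtoℚ-nonZero (suc a) = ≢-sym (<⇒≢ (ℕtoℚ-suc-pos a))

ℕtoℚ-injective : ∀ a b → ℕtoℚ a ≡ ℕtoℚ b → a ≡ b
ℕtoℚ-injective zero    zero    _  = refl
ℕtoℚ-injective zero    (suc b) eq = contradiction (sym eq) (ℕtoℚ-nonZero (suc b))
ℕtoℚ-injective (suc a) zero    eq = contradiction eq (ℕtoℚ-nonZero (suc a))
ℕtoℚ-injective (suc a) (suc b) eq = cong suc (ℕtoℚ-injective a b (∙-cancelˡ 1ℚ _ _ eq))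

/ₜ-as-* : ∀ q → ∃[ r ] (∀ p → p /ₜ q ≡ p * r) × (q ≢ 0ℚ → r * q ≡ 1ℚ)
/ₜ-as-* q with q ≟ 0ℚ
... | yes q≡0 = 0ℚ , (λ p → sym (*-zeroʳ p)) , (λ q≢0 → contradiction q≡0 q≢0)
... | no  q≢0 = 1/_ q {{≢-nonZero q≢0}} , (λ p → refl) , (λ _ → *-inverseˡ q {{≢-nonZero q≢0}})

/ₜ-zeroˡ : ∀ q → 0ℚ /ₜ q ≡ 0ℚ
/ₜ-zeroˡ q with /ₜ-as-* q
... | r , /q≡*r , _ = trans (/q≡*r 0ℚ) (*-zeroˡ r)

*-/ₜ-assoc : ∀ x y q → x * (y /ₜ q) ≡ (x * y) /ₜ q
*-/ₜ-assoc x y q with /ₜ-as-* q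
... | r , /q≡*r , _ = trans (cong (x *_) (/q≡*r y)) (trans (sym (*-assoc x y r)) (sym (/q≡*r (x * y))))

/ₜ-cancel : ∀ s c a j → s ≢ 0ℚ → (s /ₜ c) * (a * (j /ₜ s)) ≡ (a * j) /ₜ c
/ₜ-cancel s c a j s≢0 with /ₜ-as-* c | /ₜ-as-* s
... | c⁻ , /c≡*c⁻ , _ | s⁻ , /s≡*s⁻ , s⁻s≡1 = begin
  (s /ₜ c) * (a * (j /ₜ s))   ≡⟨ cong₂ (λ u v → u * (a * v)) (/c≡*c⁻ s) (/s≡*s⁻ j) ⟩
  (s * c⁻) * (a * (j * s⁻))   ≡⟨ solve 5 (λ s c a j s⁻ → (s :* c) :* (a :* (j :* s⁻))
                                                   := (s⁻ :* s) :* ((a :* j) :* c)) refl s c⁻ a j s⁻ ⟩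
  (s⁻ * s) * ((a * j) * c⁻)   ≡⟨ cong (_* _) (s⁻s≡1 s≢0) ⟩
  1ℚ * ((a * j) * c⁻)         ≡⟨ *-identityˡ _ ⟩
  (a * j) * c⁻                ≡⟨ sym (/c≡*c⁻ (a * j)) ⟩
  (a * j) /ₜ c                ∎
  where open ≡-Reasoning

∑ : {A : Set} → List A → (A → ℚ) → ℚ
∑ xs f = sumℚ (map f xs)

private variable A B : Set

∑-cong : ∀ (xs : List A) {f g : A → ℚ} → (∀ x → f x ≡ g x) → ∑ xs f ≡ ∑ xs g
∑-cong []       f≗g = refl
∑-cong (x ∷ xs) f≗g = cong₂ _+_ (f≗g x) (∑-cong xs f≗g)

∑-zero : ∀ (xs : List A) {f : A → ℚ} → (∀ x → f x ≡ 0ℚ) → ∑ xs f ≡ 0ℚ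
∑-zero []       f≗0 = refl
∑-zero (x ∷ xs) f≗0 = cong₂ _+_ (f≗0 x) (∑-zero xs f≗0)

∑-distrib-+ : ∀ (xs : List A) (f g : A → ℚ) → ∑ xs (λ x → f x + g x) ≡ ∑ xs f + ∑ xs g
∑-distrib-+ []       f g = refl
∑-distrib-+ (x ∷ xs) f g = trans (cong (f x + g x +_) (∑-distrib-+ xs f g))
  (solve 4 (λ a b c d → (a :+ b) :+ (c :+ d) := (a :+ c) :+ (b :+ d)) refl (f x) (g x) (∑ xs f) (∑ xs g))

∑-*ˡ : ∀ (xs : List A) c (f : A → ℚ) → ∑ xs (λ x → c * f x) ≡ c * ∑ xs f
∑-*ˡ []       c f = sym (*-zeroʳ c)
∑-*ˡ (x ∷ xs) c f = trans (cong (c * f x +_) (∑-*ˡ xs c f)) (sym (*-distribˡ-+ c (f x) (∑ xs f)))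

∑-/ₜ : ∀ (xs : List A) (f : A → ℚ) q → ∑ xs (λ x → f x /ₜ q) ≡ ∑ xs f /ₜ q
∑-/ₜ xs f q with /ₜ-as-* q
... | r , /q≡*r , _ = begin
  ∑ xs (λ x → f x /ₜ q) ≡⟨ ∑-cong xs (λ x → trans (/q≡*r (f x)) (*-comm (f x) r)) ⟩
  ∑ xs (λ x → r * f x)  ≡⟨ ∑-*ˡ xs r f ⟩
  r * ∑ xs f            ≡⟨ *-comm r (∑ xs f) ⟩
  ∑ xs f * r            ≡⟨ sym (/q≡*r (∑ xs f)) ⟩
  ∑ xs f /ₜ q           ∎
  where open ≡-Reasoning

∑-comm : ∀ (xs : List A) (ys : List B) (g : A → B → ℚ) →
         ∑ xs (λ x → ∑ ys (g x)) ≡ ∑ ys (λ y → ∑ xs (λ x → g x y))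
∑-comm []       ys g = sym (∑-zero ys (λ _ → refl))
∑-comm (x ∷ xs) ys g = trans (cong (∑ ys (g x) +_) (∑-comm xs ys g))
                             (sym (∑-distrib-+ ys (g x) (λ y → ∑ xs (λ x → g x y))))

∑-++ : ∀ (xs ys : List A) (f : A → ℚ) → ∑ (xs ++ ys) f ≡ ∑ xs f + ∑ ys f
∑-++ []       ys f = sym (+-identityˡ _)
∑-++ (x ∷ xs) ys f = trans (cong (f x +_) (∑-++ xs ys f)) (sym (+-assoc (f x) (∑ xs f) (∑ ys f)))

∑-map : ∀ (h : A → B) (xs : List A) (f : B → ℚ) → ∑ (map h xs) f ≡ ∑ xs (f ∘ h)
∑-map h xs f = cong sumℚ (sym (map-∘ xs))

∑-filter : ∀ {P : A → Set} (P? : ∀ x → Dec (P x)) (xs : List A) (f : A → ℚ) →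
           ∑ (filter P? xs) f ≡ ∑ xs (λ x → 𝟙 ⌊ P? x ⌋ * f x)
∑-filter P? []       f = refl
∑-filter P? (x ∷ xs) f with P? x
... | yes _ = cong₂ _+_ (sym (*-identityˡ (f x))) (∑-filter P? xs f)
... | no  _ = trans (∑-filter P? xs f) (sym (trans (cong (_+ _) (*-zeroˡ (f x))) (+-identityˡ _)))

length-filter-∑ : ∀ {P : A → Set} (P? : ∀ x → Dec (P x)) (xs : List A) →
                  ℕtoℚ (length (filter P? xs)) ≡ ∑ xs (λ x → 𝟙 ⌊ P? x ⌋)
length-filter-∑ P? []       = refl
length-filter-∑ P? (x ∷ xs) with P? x
... | yes _ = cong (1ℚ +_) (length-filter-∑ P? xs)
... | no  _ = trans (length-filter-∑ P? xs) (sym (+-identityˡ _))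

∑-1 : ∀ (xs : List A) → ∑ xs (λ _ → 1ℚ) ≡ ℕtoℚ (length xs)
∑-1 []       = refl
∑-1 (x ∷ xs) = cong (1ℚ +_) (∑-1 xs)

∑-nonNeg : ∀ (xs : List A) (f : A → ℚ) → (∀ x → 0ℚ ≤ f x) → 0ℚ ≤ ∑ xs f
∑-nonNeg []       f f≥0 = ≤-refl
∑-nonNeg (x ∷ xs) f f≥0 = +-mono-≤ (f≥0 x) (∑-nonNeg xs f f≥0)

∑-pos : ∀ (xs : List A) (f : A → ℚ) → (∀ x → 0ℚ ≤ f x) → ∀ {y} → y ∈ₗ xs → 0ℚ < f y → 0ℚ < ∑ xs f
∑-pos (x ∷ xs) f f≥0 (here refl) fy>0 = +-mono-<-≤ fy>0 (∑-nonNeg xs f f≥0)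
∑-pos (x ∷ xs) f f≥0 (there y∈xs) fy>0 = +-mono-≤-< (f≥0 x) (∑-pos xs f f≥0 y∈xs fy>0)

∑-allFin-suc : ∀ n (f : Fin (suc n) → ℚ) →
               ∑ (allFin (suc n)) f ≡ f Fin.zero + ∑ (allFin n) (f ∘ Fin.suc)
∑-allFin-suc n f = cong (λ xs → f Fin.zero + sumℚ xs)
  (trans (map-tabulate Fin.suc f) (sym (map-tabulate id (f ∘ Fin.suc))))

∑-allFin-δ : ∀ {n} (x : Fin n) (g : Fin n → ℚ) → (∀ j → j ≢ x → g j ≡ 0ℚ) → ∑ (allFin n) g ≡ g x
∑-allFin-δ {suc n} Fin.zero g g≡0 = begin
  ∑ (allFin (suc n)) g                   ≡⟨ ∑-allFin-suc n g ⟩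
  g Fin.zero + ∑ (allFin n) (g ∘ Fin.suc)
    ≡⟨ cong (g Fin.zero +_) (∑-zero (allFin n) λ j → g≡0 (Fin.suc j) λ ()) ⟩
  g Fin.zero + 0ℚ                         ≡⟨ +-identityʳ _ ⟩
  g Fin.zero                              ∎
  where open ≡-Reasoning
∑-allFin-δ {suc n} (Fin.suc x) g g≡0 = begin
  ∑ (allFin (suc n)) g                   ≡⟨ ∑-allFin-suc n g ⟩
  g Fin.zero + ∑ (allFin n) (g ∘ Fin.suc)
    ≡⟨ cong₂ _+_ (g≡0 Fin.zero λ ())
                 (∑-allFin-δ x (g ∘ Fin.suc) λ j j≢x → g≡0 (Fin.suc j) (j≢x ∘ FinP.suc-injective)) ⟩
  0ℚ + g (Fin.suc x)                      ≡⟨ +-identityˡ _ ⟩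
  g (Fin.suc x)                           ∎
  where open ≡-Reasoning

∑-allSubsets-suc : ∀ m (f : Subset (suc m) → ℚ) →
  ∑ (allSubsets (suc m)) f ≡ ∑ (allSubsets m) (f ∘ (outside ∷_)) + ∑ (allSubsets m) (f ∘ (inside ∷_))
∑-allSubsets-suc m f = trans (∑-++ (map (outside ∷_) (allSubsets m)) _ f)
  (cong₂ _+_ (∑-map (outside ∷_) (allSubsets m) f) (∑-map (inside ∷_) (allSubsets m) f))

∑-allSubsets-δ : ∀ {m} (x : Subset m) (g : Subset m → ℚ) → (∀ S → S ≢ x → g S ≡ 0ℚ) →
                 ∑ (allSubsets m) g ≡ g x
∑-allSubsets-δ []      g _   = +-identityʳ (g [])
∑-allSubsets-δ {suc m} (false ∷ x) g g≡0 = begin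
  ∑ (allSubsets (suc m)) g                  ≡⟨ ∑-allSubsets-suc m g ⟩
  ∑ (allSubsets m) (g ∘ (false ∷_)) + ∑ (allSubsets m) (g ∘ (true ∷_))
    ≡⟨ cong₂ _+_ (∑-allSubsets-δ x (g ∘ (false ∷_)) (λ S S≢x → g≡0 _ (S≢x ∘ ∷-injectiveʳ)))
                 (∑-zero (allSubsets m) (λ S → g≡0 _ (λ ()))) ⟩
  g (false ∷ x) + 0ℚ                        ≡⟨ +-identityʳ _ ⟩
  g (false ∷ x)                             ∎
  where open ≡-Reasoning
∑-allSubsets-δ {suc m} (true ∷ x) g g≡0 = begin
  ∑ (allSubsets (suc m)) g                  ≡⟨ ∑-allSubsets-suc m g ⟩
  ∑ (allSubsets m) (g ∘ (false ∷_)) + ∑ (allSubsets m) (g ∘ (true ∷_))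
    ≡⟨ cong₂ _+_ (∑-zero (allSubsets m) (λ S → g≡0 _ (λ ())))
                 (∑-allSubsets-δ x (g ∘ (true ∷_)) (λ S S≢x → g≡0 _ (S≢x ∘ ∷-injectiveʳ))) ⟩
  0ℚ + g (true ∷ x)                         ≡⟨ +-identityˡ _ ⟩
  g (true ∷ x)                              ∎
  where open ≡-Reasoning

∑-allSubsets-𝟙≟ : ∀ {m} (x : Subset m) (g : Subset m → ℚ) →
                  ∑ (allSubsets m) (λ S → 𝟙 ⌊ x ≟ₛ S ⌋ * g S) ≡ g x
∑-allSubsets-𝟙≟ x g = begin
  ∑ (allSubsets _) (λ S → 𝟙 ⌊ x ≟ₛ S ⌋ * g S) ≡⟨ ∑-allSubsets-δ x _ off ⟩
  𝟙 ⌊ x ≟ₛ x ⌋ * g x                         ≡⟨ cong (λ b → 𝟙 b * g x) (⌊⌋-yes (x ≟ₛ x) refl) ⟩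
  1ℚ * g x                                   ≡⟨ *-identityˡ (g x) ⟩
  g x                                        ∎
  where
  open ≡-Reasoning
  off : ∀ S → S ≢ x → 𝟙 ⌊ x ≟ₛ S ⌋ * g S ≡ 0ℚ
  off S S≢x = trans (cong (λ b → 𝟙 b * g S) (⌊⌋-no (x ≟ₛ S) (S≢x ∘ sym))) (*-zeroˡ (g S))

∣p∣-as-∑ : ∀ {m} (p : Subset m) → ℕtoℚ ∣ p ∣ ≡ ∑ (allFin m) (λ v → 𝟙 (lookup p v))
∣p∣-as-∑ []                = refl
∣p∣-as-∑ {suc m} (true ∷ p)  =
  trans (cong (1ℚ +_) (∣p∣-as-∑ p)) (sym (∑-allFin-suc m (λ v → 𝟙 (lookup (true ∷ p) v))))
∣p∣-as-∑ {suc m} (false ∷ p) =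
  trans (∣p∣-as-∑ p)
        (trans (sym (+-identityˡ _)) (sym (∑-allFin-suc m (λ v → 𝟙 (lookup (false ∷ p) v)))))

module _ {m : ℕ} where

  ∣p∣≡1⇒nonempty : ∀ {p : Subset m} → ∣ p ∣ ≡ 1 → Nonempty p
  ∣p∣≡1⇒nonempty {p} ∣p∣≡1 with nonempty? p
  ... | yes ne = ne
  ... | no  ¬ne = contradiction (trans (sym (∣⊥∣≡0 m)) (trans (cong ∣_∣ (sym (Empty-unique ¬ne))) ∣p∣≡1))
                                λ ()

  ∣p∣≤1⇒∈-unique : ∀ {p : Subset m} {x y} → ∣ p ∣ ℕ.≤ 1 → x ∈ p → y ∈ p → x ≡ y
  ∣p∣≤1⇒∈-unique {p} {x} {y} ∣p∣≤1 x∈p y∈p with x Fin.≟ y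
  ... | yes x≡y = x≡y
  ... | no  x≢y = contradiction (ℕP.≤-trans 2≤∣p∣ ∣p∣≤1) λ { (ℕ.s≤s ()) }
    where
    y∈p-x : y ∈ p - x
    y∈p-x = x∈p∧x≢y⇒x∈p-y y∈p (x≢y ∘ sym)
    2≤∣p∣ : 2 ℕ.≤ ∣ p ∣
    2≤∣p∣ = ℕP.≤-trans (ℕ.s≤s (ℕP.≤-trans (ℕ.s≤s ℕ.z≤n) (x∈p⇒∣p-x∣<∣p∣ y∈p-x)))
                       (x∈p⇒∣p-x∣<∣p∣ x∈p)

  ℕtoℚ∣p∣≡𝟙-nonempty : ∀ (p : Subset m) → ∣ p ∣ ℕ.≤ 1 → ℕtoℚ ∣ p ∣ ≡ 𝟙 ⌊ nonempty? p ⌋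
  ℕtoℚ∣p∣≡𝟙-nonempty p ∣p∣≤1 with nonempty? p
  ... | yes (x , x∈p) = cong ℕtoℚ (ℕP.≤-antisym ∣p∣≤1 (ℕP.≤-trans (ℕ.s≤s ℕ.z≤n) (x∈p⇒∣p-x∣<∣p∣ x∈p)))
  ... | no  ¬ne       = cong ℕtoℚ (trans (cong ∣_∣ (Empty-unique ¬ne)) (∣⊥∣≡0 m))

  ∈-tabulate⁻ : ∀ {g : Fin m → Bool} {v} → v ∈ tabulate g → g v ≡ true
  ∈-tabulate⁻ {g} {v} v∈ = trans (sym (lookup∘tabulate g v)) ([]=⇒lookup v∈)

  ∈-tabulate⁺ : ∀ {g : Fin m → Bool} {v} → g v ≡ true → v ∈ tabulate g
  ∈-tabulate⁺ {g} {v} gv≡true = lookup⇒[]= v (tabulate g) (trans (lookup∘tabulate g v) gv≡true)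

module _ {m n : ℕ} (side : Fin m → Fin n) where

  ∈-sideSet⁻ : ∀ {v j} → v ∈ sideSet side j → side v ≡ j
  ∈-sideSet⁻ {v} {j} v∈ = ⌊⌋-true⇒ (side v Fin.≟ j) (∈-tabulate⁻ v∈)

  ∈-sideSet⁺ : ∀ {v j} → side v ≡ j → v ∈ sideSet side j
  ∈-sideSet⁺ {v} {j} eq = ∈-tabulate⁺ (⌊⌋-yes (side v Fin.≟ j) eq)

  ∈-∩-sideSet⁻ : ∀ {α v j} → v ∈ α ∩ sideSet side j → v ∈ α × side v ≡ j
  ∈-∩-sideSet⁻ {α} v∈ with x∈p∩q⁻ α _ v∈
  ... | v∈α , v∈side = v∈α , ∈-sideSet⁻ v∈side

  ∈-∩-sideSet⁺ : ∀ {α v j} → v ∈ α → side v ≡ j → v ∈ α ∩ sideSet side j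
  ∈-∩-sideSet⁺ v∈α eq = x∈p∩q⁺ (v∈α , ∈-sideSet⁺ eq)

  ∈-typeOf⁻ : ∀ {α j} → j ∈ typeOf side α → ∃[ v ] v ∈ α × side v ≡ j
  ∈-typeOf⁻ {α} {j} j∈ with ⌊⌋-true⇒ (nonempty? (α ∩ sideSet side j)) (∈-tabulate⁻ j∈)
  ... | v , v∈ = v , ∈-∩-sideSet⁻ v∈

  ∈-typeOf⁺ : ∀ {α v} → v ∈ α → side v ∈ typeOf side α
  ∈-typeOf⁺ {α} {v} v∈α =
    ∈-tabulate⁺ (⌊⌋-yes (nonempty? (α ∩ sideSet side (side v))) (v , ∈-∩-sideSet⁺ v∈α refl))

  ∈-restrictTo⁻ : ∀ {ω S v} → v ∈ restrictTo side ω S → v ∈ ω × side v ∈ S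
  ∈-restrictTo⁻ {ω} {S} {v} v∈ with lookup ω v in ωv | lookup S (side v) in Sv | ∈-tabulate⁻ v∈
  ... | true | true | _ = lookup⇒[]= v ω ωv , lookup⇒[]= (side v) S Sv

  ∈-restrictTo⁺ : ∀ {ω S v} → v ∈ ω → side v ∈ S → v ∈ restrictTo side ω S
  ∈-restrictTo⁺ v∈ω sv∈S = ∈-tabulate⁺ (cong₂ _∧_ ([]=⇒lookup v∈ω) ([]=⇒lookup sv∈S))

  restrictTo-⊆ : ∀ {ω S} → restrictTo side ω S ⊆ ω
  restrictTo-⊆ {ω} {S} v∈ = proj₁ (∈-restrictTo⁻ {ω} {S} v∈)

  ∑-𝟙-∩-sideSet : ∀ α v → ∑ (allFin n) (λ j → 𝟙 (lookup (α ∩ sideSet side j) v)) ≡ 𝟙 (lookup α v)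
  ∑-𝟙-∩-sideSet α v = trans (∑-allFin-δ (side v) _ vanish) (cong 𝟙 own-side)
    where
    lookup-∩ : ∀ j → lookup (α ∩ sideSet side j) v ≡ lookup α v ∧ ⌊ side v Fin.≟ j ⌋
    lookup-∩ j = trans (lookup-zipWith _∧_ v α _) (cong (lookup α v ∧_) (lookup∘tabulate _ v))
    own-side : lookup (α ∩ sideSet side (side v)) v ≡ lookup α v
    own-side = trans (lookup-∩ (side v))
      (trans (cong (lookup α v ∧_) (⌊⌋-yes (side v Fin.≟ side v) refl)) (∧-identityʳ _))
    vanish : ∀ j → j ≢ side v → 𝟙 (lookup (α ∩ sideSet side j) v) ≡ 0ℚ
    vanish j j≢sv = cong 𝟙 (trans (lookup-∩ j)
      (trans (cong (lookup α v ∧_) (⌊⌋-no (side v Fin.≟ j) (j≢sv ∘ sym))) (∧-zeroʳ _)))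

  ∣p∣≡∑∣p∩sideSet∣ : ∀ α → ℕtoℚ ∣ α ∣ ≡ ∑ (allFin n) (λ j → ℕtoℚ ∣ α ∩ sideSet side j ∣)
  ∣p∣≡∑∣p∩sideSet∣ α = begin
    ℕtoℚ ∣ α ∣
      ≡⟨ ∣p∣-as-∑ α ⟩
    ∑ (allFin m) (λ v → 𝟙 (lookup α v))
      ≡⟨ ∑-cong (allFin m) (λ v → sym (∑-𝟙-∩-sideSet α v)) ⟩
    ∑ (allFin m) (λ v → ∑ (allFin n) (λ j → 𝟙 (lookup (α ∩ sideSet side j) v)))
      ≡⟨ ∑-comm (allFin m) (allFin n) _ ⟩
    ∑ (allFin n) (λ j → ∑ (allFin m) (λ v → 𝟙 (lookup (α ∩ sideSet side j) v)))
      ≡⟨ ∑-cong (allFin n) (λ j → sym (∣p∣-as-∑ (α ∩ sideSet side j))) ⟩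
    ∑ (allFin n) (λ j → ℕtoℚ ∣ α ∩ sideSet side j ∣) ∎
    where open ≡-Reasoning

  ∣typeOf∣≡∣∣ : ∀ α → (∀ j → ∣ α ∩ sideSet side j ∣ ℕ.≤ 1) → ∣ typeOf side α ∣ ≡ ∣ α ∣
  ∣typeOf∣≡∣∣ α ∣∩∣≤1 = ℕtoℚ-injective _ _ (begin
    ℕtoℚ ∣ typeOf side α ∣
      ≡⟨ ∣p∣-as-∑ (typeOf side α) ⟩
    ∑ (allFin n) (λ j → 𝟙 (lookup (typeOf side α) j))
      ≡⟨ ∑-cong (allFin n) (λ j → cong 𝟙 (lookup∘tabulate _ j)) ⟩
    ∑ (allFin n) (λ j → 𝟙 ⌊ nonempty? (α ∩ sideSet side j) ⌋)
      ≡⟨ ∑-cong (allFin n) (λ j → sym (ℕtoℚ∣p∣≡𝟙-nonempty _ (∣∩∣≤1 j))) ⟩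
    ∑ (allFin n) (λ j → ℕtoℚ ∣ α ∩ sideSet side j ∣)
      ≡⟨ sym (∣p∣≡∑∣p∩sideSet∣ α) ⟩
    ℕtoℚ ∣ α ∣ ∎)
    where open ≡-Reasoning

-- Transversals

IsTransversal : ∀ {m n} → (Fin m → Fin n) → Subset m → Set
IsTransversal side f = ∀ j → ∣ f ∩ sideSet side j ∣ ≡ 1

module Transversal {m n : ℕ} (side : Fin m → Fin n) (f : Subset m) (f-transversal : IsTransversal side f)
  where

  meets : ∀ j → ∃[ v ] v ∈ f × side v ≡ j
  meets j with ∣p∣≡1⇒nonempty (f-transversal j)
  ... | v , v∈ = v , ∈-∩-sideSet⁻ side v∈

  unique : ∀ {v w} → v ∈ f → w ∈ f → side v ≡ side w → v ≡ w
  unique {v} v∈f w∈f sv≡sw =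
    ∣p∣≤1⇒∈-unique (ℕP.≤-reflexive (f-transversal (side v)))
      (∈-∩-sideSet⁺ side v∈f refl) (∈-∩-sideSet⁺ side w∈f (sym sv≡sw))

  restrictTo-typeOf : ∀ {β} → β ⊆ f → restrictTo side f (typeOf side β) ≡ β
  restrictTo-typeOf {β} β⊆f = ⊆-antisym ⊆β β⊆
    where
    ⊆β : restrictTo side f (typeOf side β) ⊆ β
    ⊆β {v} v∈ with ∈-restrictTo⁻ side {f} {typeOf side β} v∈
    ... | v∈f , sv∈type with ∈-typeOf⁻ side {β} sv∈type
    ... | w , w∈β , sw≡sv = subst (_∈ β) (unique (β⊆f w∈β) v∈f sw≡sv) w∈β
    β⊆ : β ⊆ restrictTo side f (typeOf side β)
    β⊆ v∈β = ∈-restrictTo⁺ side (β⊆f v∈β) (∈-typeOf⁺ side v∈β)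

  ⌊restrictTo-typeOf≟⌋ : ∀ β → ⌊ restrictTo side f (typeOf side β) ≟ₛ β ⌋ ≡ ⌊ β ⊆? f ⌋
  ⌊restrictTo-typeOf≟⌋ β with β ⊆? f
  ... | yes β⊆f = ⌊⌋-yes (_ ≟ₛ β) (restrictTo-typeOf β⊆f)
  ... | no  β⊈f =
    ⌊⌋-no (_ ≟ₛ β) (λ eq → β⊈f (subst (_⊆ f) eq (restrictTo-⊆ side {f} {typeOf side β})))

  typeOf-restrictTo : ∀ S → typeOf side (restrictTo side f S) ≡ S
  typeOf-restrictTo S = ⊆-antisym ⊆S S⊆
    where
    ⊆S : typeOf side (restrictTo side f S) ⊆ S
    ⊆S j∈ with ∈-typeOf⁻ side {restrictTo side f S} j∈
    ... | v , v∈ , sv≡j = subst (_∈ S) sv≡j (proj₂ (∈-restrictTo⁻ side {f} {S} v∈))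
    S⊆ : S ⊆ typeOf side (restrictTo side f S)
    S⊆ {j} j∈S with meets j
    ... | v , v∈f , refl = ∈-typeOf⁺ side (∈-restrictTo⁺ side v∈f j∈S)

  ∣typeOf∣≡∣∣-⊆ : ∀ {α} → α ⊆ f → ∣ typeOf side α ∣ ≡ ∣ α ∣
  ∣typeOf∣≡∣∣-⊆ {α} α⊆f = ∣typeOf∣≡∣∣ side α λ j →
    subst (∣ α ∩ sideSet side j ∣ ℕ.≤_) (f-transversal j) (p⊆q⇒∣p∣≤∣q∣ (∩-mono α⊆f))
    where
    ∩-mono : ∀ {α j} → α ⊆ f → α ∩ sideSet side j ⊆ f ∩ sideSet side j
    ∩-mono {α} α⊆f v∈ with x∈p∩q⁻ α _ v∈
    ... | v∈α , v∈side = x∈p∩q⁺ (α⊆f v∈α , v∈side)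

  ∑-fiber-restrictTo : ∀ α (h : Subset n → ℚ) →
    ∑ (allSubsets n) (λ S → 𝟙 ⌊ restrictTo side f S ≟ₛ α ⌋ * h S) ≡ 𝟙 ⌊ α ⊆? f ⌋ * h (typeOf side α)
  ∑-fiber-restrictTo α h with α ⊆? f
  ... | yes α⊆f = trans (∑-allSubsets-δ (typeOf side α) _ off)
    (cong (λ b → 𝟙 b * h (typeOf side α)) (⌊⌋-yes (_ ≟ₛ α) (restrictTo-typeOf α⊆f)))
    where
    off : ∀ S → S ≢ typeOf side α → 𝟙 ⌊ restrictTo side f S ≟ₛ α ⌋ * h S ≡ 0ℚ
    off S S≢tα = trans (cong (λ b → 𝟙 b * h S) (⌊⌋-no (_ ≟ₛ α) λ eq →
                   S≢tα (trans (sym (typeOf-restrictTo S)) (cong (typeOf side) eq))))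
                 (*-zeroˡ (h S))
  ... | no α⊈f = trans (∑-zero (allSubsets n) off) (sym (*-zeroˡ (h (typeOf side α))))
    where
    off : ∀ S → 𝟙 ⌊ restrictTo side f S ≟ₛ α ⌋ * h S ≡ 0ℚ
    off S = trans (cong (λ b → 𝟙 b * h S)
                    (⌊⌋-no (_ ≟ₛ α) (λ eq → α⊈f (subst (_⊆ f) eq (restrictTo-⊆ side {f} {S})))))
                  (*-zeroˡ (h S))

  -- On the subsets of f, typeOf side is a bijection onto all of Subset n, inverse to restrictTo side f.
  ∑-⊆-reindex : ∀ (h : Subset n → ℚ) →
    ∑ (allSubsets m) (λ α → 𝟙 ⌊ α ⊆? f ⌋ * h (typeOf side α)) ≡ ∑ (allSubsets n) h
  ∑-⊆-reindex h = begin
    ∑ (allSubsets m) (λ α → 𝟙 ⌊ α ⊆? f ⌋ * h (typeOf side α))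
      ≡⟨ ∑-cong (allSubsets m) (λ α → sym (∑-fiber-restrictTo α h)) ⟩
    ∑ (allSubsets m) (λ α → ∑ (allSubsets n) (λ S → 𝟙 ⌊ restrictTo side f S ≟ₛ α ⌋ * h S))
      ≡⟨ ∑-comm (allSubsets m) (allSubsets n) _ ⟩
    ∑ (allSubsets n) (λ S → ∑ (allSubsets m) (λ α → 𝟙 ⌊ restrictTo side f S ≟ₛ α ⌋ * h S))
      ≡⟨ ∑-cong (allSubsets n) (λ S → ∑-allSubsets-𝟙≟ (restrictTo side f S) (λ _ → h S)) ⟩
    ∑ (allSubsets n) h ∎
    where open ≡-Reasoning

∑-outCount : ∀ {n ℓ k} (Out : Choose n ℓ → Fin k → Choose n ℓ) T →
             ∑ (allSubsets n) (λ S → ℕtoℚ (outCount Out T S)) ≡ ℕtoℚ k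
∑-outCount {n} {k = k} Out T = begin
  ∑ (allSubsets n) (λ S → ℕtoℚ (outCount Out T S))
    ≡⟨ ∑-cong (allSubsets n) (λ S → length-filter-∑ (λ a → proj₁ (Out T a) ≟ₛ S) (allFin k)) ⟩
  ∑ (allSubsets n) (λ S → ∑ (allFin k) (λ a → 𝟙 ⌊ proj₁ (Out T a) ≟ₛ S ⌋))
    ≡⟨ ∑-comm (allSubsets n) (allFin k) _ ⟩
  ∑ (allFin k) (λ a → ∑ (allSubsets n) (λ S → 𝟙 ⌊ proj₁ (Out T a) ≟ₛ S ⌋))
    ≡⟨ ∑-cong (allFin k) (λ a → trans (∑-cong (allSubsets n) (λ S → sym (*-identityʳ _)))
                                     (∑-allSubsets-𝟙≟ (proj₁ (Out T a)) (λ _ → 1ℚ))) ⟩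
  ∑ (allFin k) (λ _ → 1ℚ)
    ≡⟨ ∑-1 (allFin k) ⟩
  ℕtoℚ (length (allFin k))
    ≡⟨ cong ℕtoℚ (length-tabulate {n = k} id) ⟩
  ℕtoℚ k ∎
  where open ≡-Reasoning

outCount-off : ∀ {n ℓ k} (Out : Choose n ℓ → Fin k → Choose n ℓ) T S → ∣ S ∣ ≢ ℓ →
               ℕtoℚ (outCount Out T S) ≡ 0ℚ
outCount-off {k = k} Out T S ∣S∣≢ℓ = trans (length-filter-∑ _ (allFin k)) (∑-zero (allFin k) λ a →
  cong 𝟙 (⌊⌋-no (proj₁ (Out T a) ≟ₛ S) λ eq → ∣S∣≢ℓ (trans (cong ∣_∣ (sym eq)) (proj₂ (Out T a)))))

-- The expanderized up-down walk

module _ {n : ℕ} (X : WeightedPartiteComplex n) (ℓ : ℕ) where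
  open WeightedPartiteComplex X
  open UpDown X ℓ

  module Facet (i : Fin N) = Transversal side (facet i) (partite i)

  -- PrSup β is definitionally ΣFin N (π⊇ β).
  π⊇ : Subset m → Fin N → ℚ
  π⊇ β i = if ⌊ β ⊆? facet i ⌋ then π i else 0ℚ

  PrBoth : Subset m → Subset m → ℚ
  PrBoth α β = ΣFin N (λ i → if ⌊ α ⊆? facet i ⌋ ∧ ⌊ β ⊆? facet i ⌋ then π i else 0ℚ)

  PrBoth-comm : ∀ α β → PrBoth α β ≡ PrBoth β α
  PrBoth-comm α β = ∑-cong (allFin N) (λ i → cong (if_then π i else 0ℚ) (∧-comm ⌊ α ⊆? facet i ⌋ _))

  PrCond-typeOf : ∀ α β → PrCond (typeOf side β) β α ≡ PrBoth α β /ₜ PrSup α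
  PrCond-typeOf α β = cong (_/ₜ PrSup α) (∑-cong (allFin N) λ i →
    cong (λ b → if ⌊ α ⊆? facet i ⌋ ∧ b then π i else 0ℚ) (Facet.⌊restrictTo-typeOf≟⌋ i β))

  PrSup-face-pos : ∀ {α} → IsFace α → 0ℚ < PrSup α
  PrSup-face-pos {α} (_ , i , α⊆fᵢ) = ∑-pos (allFin N) (π⊇ α) nonNeg (∈-allFin i)
    (subst (λ b → 0ℚ < (if b then π i else 0ℚ)) (sym (⌊⌋-yes (α ⊆? facet i) α⊆fᵢ)) (π-pos i))
    where
    nonNeg : ∀ j → 0ℚ ≤ π⊇ α j
    nonNeg j with ⌊ α ⊆? facet j ⌋
    ... | true  = <⇒≤ (π-pos j)
    ... | false = ≤-refl

  ∣typeOf∣-face : ∀ {α} → IsFace α → ∣ typeOf side α ∣ ≡ ℓ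
  ∣typeOf∣-face (∣α∣≡ℓ , i , α⊆fᵢ) = trans (Facet.∣typeOf∣≡∣∣-⊆ i α⊆fᵢ) ∣α∣≡ℓ

  module _ {k : ℕ} (H : LabelledRegularGraph n ℓ k) where
    open LabelledRegularGraph H

    AH-comm : ∀ S T → AH H S T ≡ AH H T S
    AH-comm S T with ∣ S ∣ ℕ.≟ ℓ | ∣ T ∣ ℕ.≟ ℓ
    ... | yes p | yes q = symmetric (S , p) (T , q)
    ... | yes _ | no  _ = refl
    ... | no  _ | yes _ = refl
    ... | no  _ | no  _ = refl

    AH-off : ∀ S T → ∣ S ∣ ≢ ℓ → AH H S T ≡ 0ℚ
    AH-off S T ∣S∣≢ℓ with ∣ S ∣ ℕ.≟ ℓ
    ... | yes ∣S∣≡ℓ = contradiction ∣S∣≡ℓ ∣S∣≢ℓ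
    ... | no  _     = refl

    AH-outCount : ∀ T (p : ∣ T ∣ ≡ ℓ) S → AH H T S ≡ ℕtoℚ (outCount Out (T , p) S) /ₜ ℕtoℚ k
    AH-outCount T p S with ∣ T ∣ ℕ.≟ ℓ | ∣ S ∣ ℕ.≟ ℓ
    ... | no ∣T∣≢ℓ | _ = contradiction p ∣T∣≢ℓ
    ... | yes p′ | yes _ rewrite ℕP.≡-irrelevant p′ p = refl
    ... | yes _  | no ∣S∣≢ℓ =
      sym (trans (cong (_/ₜ ℕtoℚ k) (outCount-off Out (T , p) S ∣S∣≢ℓ)) (/ₜ-zeroˡ (ℕtoℚ k)))

    AH-rowSum : NonZero k → ∀ T → ∣ T ∣ ≡ ℓ → ∑ (allSubsets n) (AH H T) ≡ 1ℚ
    AH-rowSum nz T p with /ₜ-as-* (ℕtoℚ k)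
    ... | k⁻ , /k≡*k⁻ , k⁻k≡1 = begin
      ∑ (allSubsets n) (AH H T)
        ≡⟨ ∑-cong (allSubsets n) (λ S → trans (AH-outCount T p S) (/k≡*k⁻ _)) ⟩
      ∑ (allSubsets n) (λ S → ℕtoℚ (outCount Out (T , p) S) * k⁻)
        ≡⟨ ∑-cong (allSubsets n) (λ S → *-comm _ k⁻) ⟩
      ∑ (allSubsets n) (λ S → k⁻ * ℕtoℚ (outCount Out (T , p) S))
        ≡⟨ ∑-*ˡ (allSubsets n) k⁻ _ ⟩
      k⁻ * ∑ (allSubsets n) (λ S → ℕtoℚ (outCount Out (T , p) S))
        ≡⟨ cong (k⁻ *_) (∑-outCount Out (T , p)) ⟩
      k⁻ * ℕtoℚ k
        ≡⟨ k⁻k≡1 (ℕtoℚ-nonZero k {{nz}}) ⟩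
      1ℚ ∎
      where open ≡-Reasoning

    flow : ∀ {α} β → IsFace α →
           πℓ α * P̃ H α β ≡ (AH H (typeOf side α) (typeOf side β) * PrBoth α β) /ₜ ℕtoℚ (n C ℓ)
    flow {α} β α-face = begin
      πℓ α * P̃ H α β
        ≡⟨ cong (λ q → πℓ α * (AH H (typeOf side α) (typeOf side β) * q)) (PrCond-typeOf α β) ⟩
      (PrSup α /ₜ ℕtoℚ (n C ℓ)) * (AH H (typeOf side α) (typeOf side β) * (PrBoth α β /ₜ PrSup α))
        ≡⟨ /ₜ-cancel (PrSup α) (ℕtoℚ (n C ℓ)) (AH H (typeOf side α) (typeOf side β)) (PrBoth α β)
                     (≢-sym (<⇒≢ (PrSup-face-pos α-face))) ⟩
      (AH H (typeOf side α) (typeOf side β) * PrBoth α β) /ₜ ℕtoℚ (n C ℓ) ∎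
      where open ≡-Reasoning

    reversible : ∀ α β → IsFace α → IsFace β → πℓ α * P̃ H α β ≡ πℓ β * P̃ H β α
    reversible α β α-face β-face = begin
      πℓ α * P̃ H α β
        ≡⟨ flow β α-face ⟩
      (AH H (typeOf side α) (typeOf side β) * PrBoth α β) /ₜ ℕtoℚ (n C ℓ)
        ≡⟨ cong₂ (λ a j → (a * j) /ₜ ℕtoℚ (n C ℓ))
                 (AH-comm (typeOf side α) (typeOf side β)) (PrBoth-comm α β) ⟩
      (AH H (typeOf side β) (typeOf side α) * PrBoth β α) /ₜ ℕtoℚ (n C ℓ)
        ≡⟨ sym (flow α β-face) ⟩
      πℓ β * P̃ H β α ∎
      where open ≡-Reasoning

    ∑-faces-⊆-facet : NonZero k → ∀ T → ∣ T ∣ ≡ ℓ → ∀ i →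
      ∑ (allSubsets m) (λ α → 𝟙 ⌊ α ⊆? facet i ⌋ * (𝟙 ⌊ isFace? α ⌋ * AH H (typeOf side α) T)) ≡ 1ℚ
    ∑-faces-⊆-facet nz T ∣T∣≡ℓ i = begin
      ∑ (allSubsets m) (λ α → 𝟙 ⌊ α ⊆? facet i ⌋ * (𝟙 ⌊ isFace? α ⌋ * AH H (typeOf side α) T))
        ≡⟨ ∑-cong (allSubsets m) (λ α → 𝟙-*-cong (α ⊆? facet i) (only-faces α)) ⟩
      ∑ (allSubsets m) (λ α → 𝟙 ⌊ α ⊆? facet i ⌋ * AH H (typeOf side α) T)
        ≡⟨ Facet.∑-⊆-reindex i (λ S → AH H S T) ⟩
      ∑ (allSubsets n) (λ S → AH H S T)
        ≡⟨ ∑-cong (allSubsets n) (λ S → AH-comm S T) ⟩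
      ∑ (allSubsets n) (AH H T)
        ≡⟨ AH-rowSum nz T ∣T∣≡ℓ ⟩
      1ℚ ∎
      where
      open ≡-Reasoning
      only-faces : ∀ α → α ⊆ facet i → 𝟙 ⌊ isFace? α ⌋ * AH H (typeOf side α) T ≡ AH H (typeOf side α) T
      only-faces α α⊆fᵢ with isFace? α
      ... | yes _       = *-identityˡ (AH H (typeOf side α) T)
      ... | no  ¬α-face = trans (*-zeroˡ (AH H (typeOf side α) T)) (sym (AH-off (typeOf side α) T
                            λ ∣tα∣≡ℓ → ¬α-face (trans (sym (Facet.∣typeOf∣≡∣∣-⊆ i α⊆fᵢ)) ∣tα∣≡ℓ , i , α⊆fᵢ)))

    flow-via-facets : ∀ α β →
      𝟙 ⌊ isFace? α ⌋ * (πℓ α * P̃ H α β)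
        ≡ ∑ (allFin N) (λ i → π⊇ β i *
                         (𝟙 ⌊ α ⊆? facet i ⌋ * (𝟙 ⌊ isFace? α ⌋ * AH H (typeOf side α) (typeOf side β))))
          /ₜ ℕtoℚ (n C ℓ)
    flow-via-facets α β = begin
      𝟙face * (πℓ α * P̃ H α β)
        ≡⟨ 𝟙-*-cong (isFace? α) (flow β) ⟩
      𝟙face * ((Aαβ * PrBoth α β) /ₜ ℕtoℚ (n C ℓ))
        ≡⟨ *-/ₜ-assoc 𝟙face (Aαβ * PrBoth α β) (ℕtoℚ (n C ℓ)) ⟩
      (𝟙face * (Aαβ * PrBoth α β)) /ₜ ℕtoℚ (n C ℓ)
        ≡⟨ cong (λ J → (𝟙face * (Aαβ * J)) /ₜ ℕtoℚ (n C ℓ))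
                (∑-cong (allFin N) λ i → if-∧-then-0 ⌊ α ⊆? facet i ⌋ _ (π i)) ⟩
      (𝟙face * (Aαβ * ∑ (allFin N) (λ i → 𝟙 ⌊ α ⊆? facet i ⌋ * π⊇ β i))) /ₜ ℕtoℚ (n C ℓ)
        ≡⟨ cong (_/ₜ ℕtoℚ (n C ℓ))
                (trans (sym (*-assoc 𝟙face Aαβ _)) (sym (∑-*ˡ (allFin N) (𝟙face * Aαβ) _))) ⟩
      ∑ (allFin N) (λ i → (𝟙face * Aαβ) * (𝟙 ⌊ α ⊆? facet i ⌋ * π⊇ β i)) /ₜ ℕtoℚ (n C ℓ)
        ≡⟨ cong (_/ₜ ℕtoℚ (n C ℓ)) (∑-cong (allFin N) λ i →
             solve 3 (λ F a w → F :* (a :* w) := w :* (a :* F)) refl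
                     (𝟙face * Aαβ) (𝟙 ⌊ α ⊆? facet i ⌋) (π⊇ β i)) ⟩
      ∑ (allFin N) (λ i → π⊇ β i * (𝟙 ⌊ α ⊆? facet i ⌋ * (𝟙face * Aαβ))) /ₜ ℕtoℚ (n C ℓ) ∎
      where
      open ≡-Reasoning
      𝟙face Aαβ : ℚ
      𝟙face = 𝟙 ⌊ isFace? α ⌋
      Aαβ   = AH H (typeOf side α) (typeOf side β)

    stationary : NonZero k → ∀ β → IsFace β → ∑ faces (λ α → πℓ α * P̃ H α β) ≡ πℓ β
    stationary nz β β-face = begin
      ∑ faces (λ α → πℓ α * P̃ H α β)
        ≡⟨ ∑-filter isFace? (allSubsets m) _ ⟩
      ∑ (allSubsets m) (λ α → 𝟙 ⌊ isFace? α ⌋ * (πℓ α * P̃ H α β))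
        ≡⟨ ∑-cong (allSubsets m) (λ α → flow-via-facets α β) ⟩
      ∑ (allSubsets m) (λ α → ∑ (allFin N) (λ i → π⊇ β i * g α i) /ₜ ℕtoℚ (n C ℓ))
        ≡⟨ ∑-/ₜ (allSubsets m) _ (ℕtoℚ (n C ℓ)) ⟩
      ∑ (allSubsets m) (λ α → ∑ (allFin N) (λ i → π⊇ β i * g α i)) /ₜ ℕtoℚ (n C ℓ)
        ≡⟨ cong (_/ₜ ℕtoℚ (n C ℓ)) (∑-comm (allSubsets m) (allFin N) _) ⟩
      ∑ (allFin N) (λ i → ∑ (allSubsets m) (λ α → π⊇ β i * g α i)) /ₜ ℕtoℚ (n C ℓ)
        ≡⟨ cong (_/ₜ ℕtoℚ (n C ℓ)) (∑-cong (allFin N) λ i →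
             trans (∑-*ˡ (allSubsets m) (π⊇ β i) (λ α → g α i))
                   (trans (cong (π⊇ β i *_) (∑-faces-⊆-facet nz T (∣typeOf∣-face β-face) i))
                          (*-identityʳ _))) ⟩
      PrSup β /ₜ ℕtoℚ (n C ℓ) ∎
      where
      open ≡-Reasoning
      T : Subset n
      T = typeOf side β
      g : Subset m → Fin N → ℚ
      g α i = 𝟙 ⌊ α ⊆? facet i ⌋ * (𝟙 ⌊ isFace? α ⌋ * AH H (typeOf side α) T)

proposition3p4 : ∀ {n : ℕ} (X : WeightedPartiteComplex n) (ℓ : ℕ) → ℓ ℕ.≤ n →
    ∀ {k : ℕ} → NonZero k → (H : LabelledRegularGraph n ℓ k) →
    let open UpDown X ℓ in
    (∀ ω̃ → IsFace ω̃ → sumℚ (map (λ ω̂ → πℓ ω̂ * P̃ H ω̂ ω̃) faces) ≡ πℓ ω̃)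
    × (∀ ω̂ ω̃ → IsFace ω̂ → IsFace ω̃ → πℓ ω̂ * P̃ H ω̂ ω̃ ≡ πℓ ω̃ * P̃ H ω̃ ω̂)
proposition3p4 X ℓ _ nz H = stationary X ℓ H nz , reversible X ℓ H
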